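{- Let $\mathcal{C}$ be a path category and let $\mathcal{C}_p$ be the full subcategory of $\mathcal{C}$ whose objects are the paths. Every object of $\mathcal{C}$ is path-generated if and only if the inclusion functor $J\colon\mathcal{C}_p\hookrightarrow\mathcal{C}$ is dense, i.e. every object $X$ of $\mathcal{C}$ is the colimit of the diagram $J{\downarrow}X\xrightarrow{\pi}\mathcal{C}_p\xrightarrow{J}\mathcal{C}$ (with its canonical cocone), where $J{\downarrow}X$ is the comma category and $\pi$ the forgetful functor.
   Context: All categories are locally small and well-powered. Given morphisms $e,m$, say $e$ has the left lifting property with respect to $m$ if for every commutative square $v\circ e=m\circ u$ there is $d$ with $d\circ e=u$ and $m\circ d=v$. A weak factorisation system on a category is a pair $(\mathcal{Q},\mathcal{M})$ of classes of morphisms such that every morphism factors as $m\circ e$ with $e\in\mathcal{Q}$, $m\in\mathcal{M}$, $\mathcal{Q}$ is exactly the class of morphisms with the left lifting property with respect to all of $\mathcal{M}$, and $\mathcal{M}$ exactly the class with the right lifting property with respect to all of $\mathcal{Q}$. It is proper if morphisms of $\mathcal{Q}$ are epi and those of $\mathcal{M}$ mono; stable if moreover for any $e\in\mathcal{Q}$, $m\in\mathcal{M}$ with common codomain the pullback of $e$ along $m$ exists and lies in $\mathcal{Q}$. Morphisms in $\mathcal{M}$ are embeddings, those in $\mathcal{Q}$ quotients. $\mathrm{Emb}\,X$ is the set of embeddings into $X$ modulo $m\sim n$ iff $m=n\circ i$ for an isomorphism $i$, ordered by $m\le n$ iff $m=n\circ i$ for some $i$. An object $P$ is a path if $\mathrm{Emb}\,P$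 is a finite chain. A path embedding is an embedding whose domain is a path; $\mathrm{Path}\,X$ is the poset of (classes of) path embeddings into $X$. An object $X$ is connected if for every non-empty small family of paths $\{P_i\}$ every morphism $X\to\coprod_i P_i$ factors through some coproduct injection. A path category is a category with a stable proper factorisation system such that: (i) it has coproducts of all small families of paths; (ii) every path is connected; (iii) for paths $P,Q,R$ and $f\colon P\to Q$, $g\colon Q\to R$, if $g\circ f$ is a quotient then so is $f$. An object $X$ is path-generated if the cocone with vertex $X$ formed by all path embeddings into $X$ (one representative per element of $\mathrm{Path}\,X$), over the small diagram whose morphisms are all morphisms between their domains making the evident triangles over $X$ commute, is a colimit cocone in $\mathcal{C}$. -}

module Defs where

open import Level using (Level; _⊔_) renaming (suc to lsuc)
open import Data.Product using (Σ; _×_; _,_; proj₁)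
open import Data.Sum using (_⊎_)
open import Data.Nat using (ℕ)
open import Data.Fin using (Fin)
open import Relation.Binary.PropositionalEquality using (_≡_)
open import Function.Bundles using (_⇔_)

-- A (locally small) category: objects in Set o, hom-sets in Set ℓ.
-- "Small" families are those indexed by a type in Set ℓ.
record Category (o ℓ : Level) : Set (lsuc (o ⊔ ℓ)) where
  infixr 9 _∘_
  field
    Obj : Set o
    _⇒_ : Obj → Obj → Set ℓ
    id  : ∀ {A} → A ⇒ A
    _∘_ : ∀ {A B C} → B ⇒ C → A ⇒ B → A ⇒ C
    identityˡ : ∀ {A B} (f : A ⇒ B) → id ∘ f ≡ f
    identityʳ : ∀ {A B} (f : A ⇒ B) → f ∘ id ≡ f
    assoc : ∀ {A B C D} (f : A ⇒ B) (g : B ⇒ C) (h : C ⇒ D) →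
            (h ∘ g) ∘ f ≡ h ∘ (g ∘ f)

module _ {o ℓ : Level} (𝒞 : Category o ℓ) where
  open Category 𝒞

  MorClass : (r : Level) → Set (o ⊔ ℓ ⊔ lsuc r)
  MorClass r = ∀ {A B} → A ⇒ B → Set r

  Epi : ∀ {A B} → A ⇒ B → Set (o ⊔ ℓ)
  Epi {A} {B} f = ∀ {Z} (g h : B ⇒ Z) → g ∘ f ≡ h ∘ f → g ≡ h

  Mono : ∀ {A B} → A ⇒ B → Set (o ⊔ ℓ)
  Mono {A} {B} f = ∀ {Z} (g h : Z ⇒ A) → f ∘ g ≡ f ∘ h → g ≡ h

  record IsIso {A B} (f : A ⇒ B) : Set ℓ where
    field
      inv  : B ⇒ A
      isoˡ : inv ∘ f ≡ id
      isoʳ : f ∘ inv ≡ id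

  LLP : ∀ {A B C D} → A ⇒ B → C ⇒ D → Set ℓ
  LLP {A} {B} {C} {D} e m =
    (u : A ⇒ C) (v : B ⇒ D) → v ∘ e ≡ m ∘ u →
    Σ (B ⇒ C) λ d → (d ∘ e ≡ u) × (m ∘ d ≡ v)

  record IsWFS {r : Level} (Q M : MorClass r) : Set (o ⊔ ℓ ⊔ r) where
    field
      factor : ∀ {A B} (f : A ⇒ B) →
        Σ Obj λ E → Σ (A ⇒ E) λ e → Σ (E ⇒ B) λ m → Q e × M m × (f ≡ m ∘ e)
      Q-is-LLP : ∀ {A B} (e : A ⇒ B) →
        Q e ⇔ (∀ {C D} (m : C ⇒ D) → M m → LLP e m)
      M-is-RLP : ∀ {C D} (m : C ⇒ D) →
        M m ⇔ (∀ {A B} (e : A ⇒ B) → Q e → LLP e m)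

  IsPullback : ∀ {A B C P} (f : A ⇒ C) (g : B ⇒ C) (p₁ : P ⇒ A) (p₂ : P ⇒ B) →
               Set (o ⊔ ℓ)
  IsPullback {A} {B} {C} {P} f g p₁ p₂ =
    (f ∘ p₁ ≡ g ∘ p₂) ×
    (∀ {Z} (h₁ : Z ⇒ A) (h₂ : Z ⇒ B) → f ∘ h₁ ≡ g ∘ h₂ →
      Σ (Z ⇒ P) λ u → (p₁ ∘ u ≡ h₁) × (p₂ ∘ u ≡ h₂) ×
        (∀ (u' : Z ⇒ P) → p₁ ∘ u' ≡ h₁ → p₂ ∘ u' ≡ h₂ → u' ≡ u))

  IsCoproduct : {I : Set ℓ} (F : I → Obj) (S : Obj) (inj : ∀ i → F i ⇒ S) →
                Set (o ⊔ ℓ)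
  IsCoproduct {I} F S inj =
    ∀ {Z} (h : ∀ i → F i ⇒ Z) →
      Σ (S ⇒ Z) λ u → (∀ i → u ∘ inj i ≡ h i) ×
        (∀ (u' : S ⇒ Z) → (∀ i → u' ∘ inj i ≡ h i) → u' ≡ u)

  -- Diagrams (only the underlying graph matters for cocones/colimits)
  record Diagram (a b : Level) : Set (o ⊔ ℓ ⊔ lsuc (a ⊔ b)) where
    field
      Ix  : Set a
      obj : Ix → Obj
      Arr : Ix → Ix → Set b
      map : ∀ {i j} → Arr i j → obj i ⇒ obj j

  module _ {a b : Level} (D : Diagram a b) where
    open Diagram D

    IsCocone : (X : Obj) → (∀ i → obj i ⇒ X) → Set (a ⊔ b ⊔ ℓ)
    IsCocone X ι = ∀ {i j} (α : Arr i j) → ι j ∘ map α ≡ ι i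

    IsColimit : (X : Obj) → (∀ i → obj i ⇒ X) → Set (o ⊔ a ⊔ b ⊔ ℓ)
    IsColimit X ι =
      IsCocone X ι ×
      (∀ (Y : Obj) (κ : ∀ i → obj i ⇒ Y) → IsCocone Y κ →
        Σ (X ⇒ Y) λ u → (∀ i → u ∘ ι i ≡ κ i) ×
          (∀ (u' : X ⇒ Y) → (∀ i → u' ∘ ι i ≡ κ i) → u' ≡ u))

  module WithEmbeddings {r : Level} (M : MorClass r) where

    EmbInto : Obj → Set (o ⊔ ℓ ⊔ r)
    EmbInto X = Σ Obj λ A → Σ (A ⇒ X) λ m → M m

    _≤E_ : ∀ {X} → EmbInto X → EmbInto X → Set ℓ
    (A , m , _) ≤E (B , n , _) = Σ (A ⇒ B) λ i → m ≡ n ∘ i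

    _∼E_ : ∀ {X} → EmbInto X → EmbInto X → Set ℓ
    (A , m , _) ∼E (B , n , _) = Σ (A ⇒ B) λ i → IsIso i × (m ≡ n ∘ i)

    -- Emb X (embeddings modulo ∼E, ordered by ≤E) is a finite chain:
    -- finitely many classes, and any two are comparable.
    EmbIsFiniteChain : Obj → Set (o ⊔ ℓ ⊔ r)
    EmbIsFiniteChain X =
      (Σ ℕ λ k → Σ (Fin k → EmbInto X) λ e →
         ∀ (x : EmbInto X) → Σ (Fin k) λ j → x ∼E e j) ×
      (∀ (x y : EmbInto X) → (x ≤E y) ⊎ (y ≤E x))

    IsPath : Obj → Set (o ⊔ ℓ ⊔ r)
    IsPath P = EmbIsFiniteChain P

    Connected : Obj → Set (o ⊔ lsuc ℓ ⊔ r)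
    Connected X =
      ∀ (I : Set ℓ) → I → (F : I → Obj) → (∀ i → IsPath (F i)) →
      ∀ (S : Obj) (inj : ∀ i → F i ⇒ S) → IsCoproduct F S inj →
      ∀ (f : X ⇒ S) → Σ I λ i → Σ (X ⇒ F i) λ g → f ≡ inj i ∘ g

    PathEmbDiagram : Obj → Diagram (o ⊔ ℓ ⊔ r) ℓ
    PathEmbDiagram X = record
      { Ix  = Σ Obj λ P → IsPath P × (Σ (P ⇒ X) λ m → M m)
      ; obj = λ { (P , _ , _) → P }
      ; Arr = λ { (P , _ , m , _) (P' , _ , m' , _) → Σ (P ⇒ P') λ h → m' ∘ h ≡ m }
      ; map = proj₁
      }

    PathGenerated : Obj → Set (o ⊔ ℓ ⊔ r)
    PathGenerated X =
      IsColimit (PathEmbDiagram X) X (λ { (_ , _ , m , _) → m })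

    -- the diagram J↓X → 𝒞_p → 𝒞 (comma category of the inclusion of the
    -- full subcategory of paths, composed with the forgetful functor)
    CommaDiagram : Obj → Diagram (o ⊔ ℓ ⊔ r) ℓ
    CommaDiagram X = record
      { Ix  = Σ Obj λ P → IsPath P × (P ⇒ X)
      ; obj = λ { (P , _ , _) → P }
      ; Arr = λ { (P , _ , f) (P' , _ , f') → Σ (P ⇒ P') λ h → f' ∘ h ≡ f }
      ; map = proj₁
      }

    InclusionDense : Set (o ⊔ ℓ ⊔ r)
    InclusionDense =
      ∀ (X : Obj) → IsColimit (CommaDiagram X) X (λ { (_ , _ , f) → f })

    record IsPathCategory (Q : MorClass r) : Set (o ⊔ lsuc ℓ ⊔ r) where
      field
        wfs : IsWFS Q M
        quotients-epi : ∀ {A B} (e : A ⇒ B) → Q e → Epi e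
        embeddings-mono : ∀ {A B} (m : A ⇒ B) → M m → Mono m
        stable : ∀ {A B C} (e : A ⇒ C) (m : B ⇒ C) → Q e → M m →
          Σ Obj λ P → Σ (P ⇒ A) λ p₁ → Σ (P ⇒ B) λ p₂ →
            IsPullback e m p₁ p₂ × Q p₂
        coproducts : ∀ (I : Set ℓ) (F : I → Obj) → (∀ i → IsPath (F i)) →
          Σ Obj λ S → Σ (∀ i → F i ⇒ S) λ inj → IsCoproduct F S inj
        paths-connected : ∀ (P : Obj) → IsPath P → Connected P
        quotient-cancel : ∀ {P P' R} → IsPath P → IsPath P' → IsPath R →
          (f : P ⇒ P') (g : P' ⇒ R) → Q (g ∘ f) → Q f

-- Every f : P → X from a path factors as a quotient P ↠ Im followed by an
-- embedding Im ↣ X, and Im is again a path: pulling embeddings back along the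
-- quotient reflects their order, and every embedding into Im is the image of
-- its pullback, so the finite chain Emb P maps onto Emb Im. Hence a cocone over
-- the path embeddings into X extends uniquely, through these images and by the
-- lifting property, to a cocone over J↓X, and every cocone over J↓X restricts;
-- so X is a colimit of one diagram iff it is a colimit of the other.
module Submission where

open import Level using (_⊔_)
open import Data.Product using (Σ; _×_; _,_; proj₁; proj₂)
import Data.Sum as Sum
open import Function.Bundles using (_⇔_; mk⇔; Equivalence)
open import Relation.Binary.PropositionalEquality
  using (_≡_; refl; sym; trans; cong; module ≡-Reasoning)
open import Defs

module CategoryFacts {o ℓ} (𝒞 : Category o ℓ) where
  open Category 𝒞
  open ≡-Reasoning

  pullback-jointly-monic : ∀ {A B C P Z} {f : A ⇒ C} {g : B ⇒ C} {p₁ : P ⇒ A} {p₂ : P ⇒ B} →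
    IsPullback 𝒞 f g p₁ p₂ → {a b : Z ⇒ P} → p₁ ∘ a ≡ p₁ ∘ b → p₂ ∘ a ≡ p₂ ∘ b → a ≡ b
  pullback-jointly-monic {f = f} {g} {p₁} {p₂} (square , universal) {a} {b} p₁a≡p₁b p₂a≡p₂b =
    let (_ , _ , _ , unique) = universal (p₁ ∘ a) (p₂ ∘ a) (begin
          f ∘ (p₁ ∘ a) ≡⟨ sym (assoc _ _ _) ⟩
          (f ∘ p₁) ∘ a ≡⟨ cong (_∘ a) square ⟩
          (g ∘ p₂) ∘ a ≡⟨ assoc _ _ _ ⟩
          g ∘ (p₂ ∘ a) ∎)
    in trans (unique a refl refl) (sym (unique b (sym p₁a≡p₁b) (sym p₂a≡p₂b)))

  module EmbeddingOrder {r} {M : MorClass 𝒞 r} where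
    open WithEmbeddings 𝒞 M

    ≤E-refl : ∀ {X} (x : EmbInto X) → x ≤E x
    ≤E-refl (_ , m , _) = id , sym (identityʳ m)

    ≤E-trans : ∀ {X} (x y z : EmbInto X) → x ≤E y → y ≤E z → x ≤E z
    ≤E-trans (_ , l , _) (_ , m , _) (_ , n , _) (i , l≡mi) (j , m≡nj) = j ∘ i , (begin
      l           ≡⟨ l≡mi ⟩
      m ∘ i       ≡⟨ cong (_∘ i) m≡nj ⟩
      (n ∘ j) ∘ i ≡⟨ assoc _ _ _ ⟩
      n ∘ (j ∘ i) ∎)

    ∼E⇒≤E : ∀ {X} (x y : EmbInto X) → x ∼E y → x ≤E y
    ∼E⇒≤E _ _ (i , _ , m≡ni) = i , m≡ni

    ∼E⇒≥E : ∀ {X} (x y : EmbInto X) → x ∼E y → y ≤E x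
    ∼E⇒≥E (_ , m , _) (_ , n , _) (i , i-iso , m≡ni) = inv , (begin
      n             ≡⟨ sym (identityʳ n) ⟩
      n ∘ id        ≡⟨ cong (n ∘_) (sym isoʳ) ⟩
      n ∘ (i ∘ inv) ≡⟨ sym (assoc _ _ _) ⟩
      (n ∘ i) ∘ inv ≡⟨ cong (_∘ inv) (sym m≡ni) ⟩
      m ∘ inv       ∎)
      where open IsIso i-iso

    ≤E-antisym : (∀ {A B} (m : A ⇒ B) → M m → Mono 𝒞 m) →
                 ∀ {X} (x y : EmbInto X) → x ≤E y → y ≤E x → x ∼E y
    ≤E-antisym M-mono (_ , m , m∈M) (_ , n , n∈M) (i , m≡ni) (j , n≡mj) =
      i , record { inv = j ; isoˡ = cancel m∈M j i n≡mj m≡ni ; isoʳ = cancel n∈M i j m≡ni n≡mj } , m≡ni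
      where
      cancel : ∀ {A B} {a : A ⇒ _} {b : B ⇒ _} → M a → (f : B ⇒ A) (g : A ⇒ B) →
               b ≡ a ∘ f → a ≡ b ∘ g → f ∘ g ≡ id
      cancel {a = a} {b} a∈M f g b≡af a≡bg = M-mono a a∈M (f ∘ g) id (begin
        a ∘ (f ∘ g) ≡⟨ sym (assoc _ _ _) ⟩
        (a ∘ f) ∘ g ≡⟨ cong (_∘ g) (sym b≡af) ⟩
        b ∘ g       ≡⟨ sym a≡bg ⟩
        a           ≡⟨ sym (identityʳ a) ⟩
        a ∘ id      ∎)

module FactorisationSystem {o ℓ r} {𝒞 : Category o ℓ} {Q M : MorClass 𝒞 r}
                           (wfs : IsWFS 𝒞 Q M) where
  open Category 𝒞
  open WithEmbeddings 𝒞 M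
  open IsWFS wfs
  open CategoryFacts 𝒞
  open EmbeddingOrder {M = M}
  open ≡-Reasoning

  lift : ∀ {A B C D} {e : A ⇒ B} {m : C ⇒ D} → Q e → M m → LLP 𝒞 e m
  lift {e = e} {m} e∈Q m∈M = Equivalence.to (Q-is-LLP e) e∈Q m m∈M

  record Image {A X} (f : A ⇒ X) : Set (o ⊔ ℓ ⊔ r) where
    field
      Im         : Obj
      quotient   : A ⇒ Im
      embedding  : Im ⇒ X
      quotient∈Q : Q quotient
      embedding∈M : M embedding
      factors    : f ≡ embedding ∘ quotient

  image : ∀ {A X} (f : A ⇒ X) → Image f
  image f = let (Im , q , m , q∈Q , m∈M , f≡mq) = factor f in
    record { Im = Im ; quotient = q ; embedding = m
           ; quotient∈Q = q∈Q ; embedding∈M = m∈M ; factors = f≡mq }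

  pullback-preserves-M : ∀ {A B C P} {f : A ⇒ C} {n : B ⇒ C} {p₁ : P ⇒ A} {p₂ : P ⇒ B} →
    IsPullback 𝒞 f n p₁ p₂ → M n → M p₁
  pullback-preserves-M {f = f} {n} {p₁} {p₂} pb@(square , universal) n∈M =
    Equivalence.from (M-is-RLP p₁) λ q q∈Q u v vq≡p₁u →
      let (d , dq≡p₂u , nd≡fv) = lift q∈Q n∈M (p₂ ∘ u) (f ∘ v) (begin
            (f ∘ v) ∘ q   ≡⟨ assoc _ _ _ ⟩
            f ∘ (v ∘ q)   ≡⟨ cong (f ∘_) vq≡p₁u ⟩
            f ∘ (p₁ ∘ u)  ≡⟨ sym (assoc _ _ _) ⟩
            (f ∘ p₁) ∘ u  ≡⟨ cong (_∘ u) square ⟩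
            (n ∘ p₂) ∘ u  ≡⟨ assoc _ _ _ ⟩
            n ∘ (p₂ ∘ u)  ∎)
          (w , p₁w≡v , p₂w≡d , _) = universal v d (sym nd≡fv)
      in w , pullback-jointly-monic pb
               (trans (sym (assoc _ _ _)) (trans (cong (_∘ q) p₁w≡v) vq≡p₁u))
               (trans (sym (assoc _ _ _)) (trans (cong (_∘ q) p₂w≡d) dq≡p₂u))
           , p₁w≡v

  dom : ∀ {X} → EmbInto X → Obj
  dom = proj₁

  arr : ∀ {X} (x : EmbInto X) → dom x ⇒ X
  arr x = proj₁ (proj₂ x)

  quotient-square⇒≤E : ∀ {X B} (x y : EmbInto X) {p : B ⇒ dom x} {g : B ⇒ dom y} →
    Q p → arr x ∘ p ≡ arr y ∘ g → x ≤E y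
  quotient-square⇒≤E _ (_ , _ , m∈M) {g = g} p∈Q square =
    let (d , _ , md≡n) = lift p∈Q m∈M g _ square in d , sym md≡n

  module StableQuotients
    (embeddings-mono : ∀ {A B} (m : A ⇒ B) → M m → Mono 𝒞 m)
    (stable : ∀ {A B C} (e : A ⇒ C) (m : B ⇒ C) → Q e → M m →
      Σ Obj λ P → Σ (P ⇒ A) λ p₁ → Σ (P ⇒ B) λ p₂ → IsPullback 𝒞 e m p₁ p₂ × Q p₂)
    {P E : Obj} {e : P ⇒ E} (e∈Q : Q e) where

    record PreimageSquare (x : EmbInto E) : Set (o ⊔ ℓ ⊔ r) where
      field
        Pb    : Obj
        p₁    : Pb ⇒ P
        p₂    : Pb ⇒ dom x
        p₁∈M  : M p₁
        p₂∈Q  : Q p₂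
        square : e ∘ p₁ ≡ arr x ∘ p₂

    preimageSquare : (x : EmbInto E) → PreimageSquare x
    preimageSquare (_ , n , n∈M) =
      let (Pb , p₁ , p₂ , pb , p₂∈Q) = stable e n e∈Q n∈M in
      record { Pb = Pb ; p₁ = p₁ ; p₂ = p₂ ; p₁∈M = pullback-preserves-M pb n∈M
             ; p₂∈Q = p₂∈Q ; square = proj₁ pb }

    preimage : EmbInto E → EmbInto P
    preimage x = Pb , p₁ , p₁∈M where open PreimageSquare (preimageSquare x)

    directImage : EmbInto P → EmbInto E
    directImage z = Im , embedding , embedding∈M where open Image (image (e ∘ arr z))

    ≤-directImage : ∀ x z → preimage x ≤E z → x ≤E directImage z
    ≤-directImage x z (k , p₁≡gk) = quotient-square⇒≤E x (directImage z) p₂∈Q (begin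
      arr x ∘ p₂                ≡⟨ sym square ⟩
      e ∘ p₁                    ≡⟨ cong (e ∘_) p₁≡gk ⟩
      e ∘ (arr z ∘ k)           ≡⟨ sym (assoc _ _ _) ⟩
      (e ∘ arr z) ∘ k           ≡⟨ cong (_∘ k) factors ⟩
      (embedding ∘ quotient) ∘ k ≡⟨ assoc _ _ _ ⟩
      embedding ∘ (quotient ∘ k) ∎)
      where open PreimageSquare (preimageSquare x)
            open Image (image (e ∘ arr z))

    directImage-≤ : ∀ x z → z ≤E preimage x → directImage z ≤E x
    directImage-≤ x z (k , g≡p₁k) = quotient-square⇒≤E (directImage z) x quotient∈Q (begin
      embedding ∘ quotient ≡⟨ sym factors ⟩
      e ∘ arr z            ≡⟨ cong (e ∘_) g≡p₁k ⟩
      e ∘ (p₁ ∘ k)         ≡⟨ sym (assoc _ _ _) ⟩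
      (e ∘ p₁) ∘ k         ≡⟨ cong (_∘ k) square ⟩
      (arr x ∘ p₂) ∘ k     ≡⟨ assoc _ _ _ ⟩
      arr x ∘ (p₂ ∘ k)     ∎)
      where open PreimageSquare (preimageSquare x)
            open Image (image (e ∘ arr z))

    preimage-reflects-≤ : ∀ x y → preimage x ≤E preimage y → x ≤E y
    preimage-reflects-≤ x y x*≤y* =
      ≤E-trans x (directImage (preimage y)) y (≤-directImage x (preimage y) x*≤y*)
               (directImage-≤ y (preimage y) (≤E-refl (preimage y)))

    quotient-preserves-path : IsPath P → IsPath E
    quotient-preserves-path ((k , f , covers) , chain) =
      (k , (λ j → directImage (f j)) , covers′) , chain′
      where
      covers′ : ∀ x → Σ _ λ j → x ∼E directImage (f j)
      covers′ x = let (j , x*∼fj) = covers (preimage x) in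
        j , ≤E-antisym embeddings-mono x (directImage (f j))
              (≤-directImage x (f j) (∼E⇒≤E (preimage x) (f j) x*∼fj))
              (directImage-≤ x (f j) (∼E⇒≥E (preimage x) (f j) x*∼fj))
      chain′ : ∀ x y → (x ≤E y) Sum.⊎ (y ≤E x)
      chain′ x y = Sum.map (preimage-reflects-≤ x y) (preimage-reflects-≤ y x)
                           (chain (preimage x) (preimage y))

  module Density
    (quotient-preserves-path : ∀ {P E} {e : P ⇒ E} → Q e → IsPath P → IsPath E) where

    PathEmbIx CommaIx : Obj → Set (o ⊔ ℓ ⊔ r)
    PathEmbIx X = Diagram.Ix (PathEmbDiagram X)
    CommaIx X = Diagram.Ix (CommaDiagram X)

    pathEmb : ∀ {X} (j : PathEmbIx X) → proj₁ j ⇒ X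
    pathEmb (_ , _ , m , _) = m

    pathMap : ∀ {X} (i : CommaIx X) → proj₁ i ⇒ X
    pathMap (_ , _ , f) = f

    asComma : ∀ {X} → PathEmbIx X → CommaIx X
    asComma (P , π , m , _) = P , π , m

    pathImage : ∀ {X} → CommaIx X → PathEmbIx X
    pathImage (_ , π , f) = Im , quotient-preserves-path quotient∈Q π , embedding , embedding∈M
      where open Image (image f)

    imageQuotient : ∀ {X} (i : CommaIx X) → proj₁ i ⇒ proj₁ (pathImage i)
    imageQuotient (_ , _ , f) = Image.quotient (image f)

    image-factors : ∀ {X} (i : CommaIx X) → pathMap i ≡ pathEmb (pathImage i) ∘ imageQuotient i
    image-factors (_ , _ , f) = Image.factors (image f)

    image-diagonal : ∀ {X} (i : CommaIx X) (j : PathEmbIx X) (h : proj₁ i ⇒ proj₁ j) →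
      pathEmb j ∘ h ≡ pathMap i →
      Σ (proj₁ (pathImage i) ⇒ proj₁ j) λ d →
        (d ∘ imageQuotient i ≡ h) × (pathEmb j ∘ d ≡ pathEmb (pathImage i))
    image-diagonal i@(_ , _ , f) (_ , _ , _ , m∈M) h mh≡f =
      lift (Image.quotient∈Q (image f)) m∈M h _ (trans (sym (image-factors i)) (sym mh≡f))

    extend : ∀ {X Y} → ((j : PathEmbIx X) → proj₁ j ⇒ Y) → (i : CommaIx X) → proj₁ i ⇒ Y
    extend κ i = κ (pathImage i) ∘ imageQuotient i

    agrees-on-images : ∀ {X Y} (κ : (j : PathEmbIx X) → proj₁ j ⇒ Y) (u : X ⇒ Y) →
      (∀ j → u ∘ pathEmb j ≡ κ j) → ∀ i → u ∘ pathMap i ≡ extend κ i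
    agrees-on-images κ u u∘m≡κ i = begin
      u ∘ pathMap i                                     ≡⟨ cong (u ∘_) (image-factors i) ⟩
      u ∘ (pathEmb (pathImage i) ∘ imageQuotient i)     ≡⟨ sym (assoc _ _ _) ⟩
      (u ∘ pathEmb (pathImage i)) ∘ imageQuotient i     ≡⟨ cong (_∘ imageQuotient i) (u∘m≡κ (pathImage i)) ⟩
      κ (pathImage i) ∘ imageQuotient i                 ∎

    module _ {X Y} (κ : (j : PathEmbIx X) → proj₁ j ⇒ Y)
             (κ-cocone : IsCocone 𝒞 (PathEmbDiagram X) Y κ) where

      extend-compatible : ∀ i j (h : proj₁ i ⇒ proj₁ j) →
        pathEmb j ∘ h ≡ pathMap i → κ j ∘ h ≡ extend κ i
      extend-compatible i j h mh≡f =
        let (d , dq≡h , md≡m) = image-diagonal i j h mh≡f in begin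
        κ j ∘ h                           ≡⟨ cong (κ j ∘_) (sym dq≡h) ⟩
        κ j ∘ (d ∘ imageQuotient i)       ≡⟨ sym (assoc _ _ _) ⟩
        (κ j ∘ d) ∘ imageQuotient i       ≡⟨ cong (_∘ imageQuotient i) (κ-cocone {pathImage i} {j} (d , md≡m)) ⟩
        κ (pathImage i) ∘ imageQuotient i ∎

      extend-cocone : IsCocone 𝒞 (CommaDiagram X) Y (extend κ)
      extend-cocone {i} {i′} (h , f′h≡f) = begin
        extend κ i′ ∘ h                                 ≡⟨ assoc _ _ _ ⟩
        κ (pathImage i′) ∘ (imageQuotient i′ ∘ h)       ≡⟨ extend-compatible i (pathImage i′) _ (begin
          pathEmb (pathImage i′) ∘ (imageQuotient i′ ∘ h) ≡⟨ sym (assoc _ _ _) ⟩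
          (pathEmb (pathImage i′) ∘ imageQuotient i′) ∘ h ≡⟨ cong (_∘ h) (sym (image-factors i′)) ⟩
          pathMap i′ ∘ h                                  ≡⟨ f′h≡f ⟩
          pathMap i                                       ∎) ⟩
        extend κ i                                      ∎

      extend-restricts : ∀ j → extend κ (asComma j) ≡ κ j
      extend-restricts j =
        trans (sym (extend-compatible (asComma j) j id (identityʳ _))) (identityʳ (κ j))

    path-generated⇔colimit : ∀ X →
      PathGenerated X ⇔ IsColimit 𝒞 (CommaDiagram X) X pathMap
    path-generated⇔colimit X = mk⇔ to from
      where
      to : PathGenerated X → IsColimit 𝒞 (CommaDiagram X) X pathMap
      to (_ , universal) = proj₂ , λ Y κ κ-cocone →
        let (u , u-factors , u-unique) =
              universal Y (λ j → κ (asComma j)) (λ {j} {j′} → κ-cocone {asComma j} {asComma j′})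
        in u
         , (λ i → trans (agrees-on-images (λ j → κ (asComma j)) u u-factors i)
                        (κ-cocone {i} {asComma (pathImage i)} (imageQuotient i , sym (image-factors i))))
         , λ u′ u′-factors → u-unique u′ (λ j → u′-factors (asComma j))

      from : IsColimit 𝒞 (CommaDiagram X) X pathMap → PathGenerated X
      from (_ , universal) = proj₂ , λ Y κ κ-cocone →
        let (u , u-factors , u-unique) = universal Y (extend κ) (extend-cocone κ κ-cocone)
        in u
         , (λ j → trans (u-factors (asComma j)) (extend-restricts κ κ-cocone j))
         , λ u′ u′-factors → u-unique u′ (agrees-on-images κ u′ u′-factors)

lemma5p1 : ∀ {o ℓ r} (𝒞 : Category o ℓ) (Q M : MorClass 𝒞 r) →
    WithEmbeddings.IsPathCategory 𝒞 M Q →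
    ((∀ (X : Category.Obj 𝒞) → WithEmbeddings.PathGenerated 𝒞 M X) ⇔
     WithEmbeddings.InclusionDense 𝒞 M)
lemma5p1 𝒞 Q M pc =
  mk⇔ (λ generated X → Equivalence.to (path-generated⇔colimit X) (generated X))
      (λ dense X → Equivalence.from (path-generated⇔colimit X) (dense X))
  where
  open WithEmbeddings.IsPathCategory pc
  open FactorisationSystem wfs
  open Density (λ e∈Q → StableQuotients.quotient-preserves-path embeddings-mono stable e∈Q)
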